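{- For every integer $n \ge 2$, every perfect matching $M$ of the $n$-dimensional hypercube $Q_n$ has forcing number at least $2^{n-2}$.
   Context: The $n$-dimensional hypercube $Q_n$ has vertex set $\{0,1\}^n$, two vertices being adjacent iff they differ in exactly one coordinate. For a perfect matching $M$ of a graph $G$, a subset $S \subseteq M$ is a forcing set of $M$ if $M$ is the only perfect matching of $G$ containing $S$. The forcing number of $M$ is the minimum size of a forcing set of $M$. -}

module Defs where

open import Data.Nat using (ℕ)
open import Data.Bool using (Bool)
open import Data.Fin using (Fin)
open import Data.Vec using (Vec; lookup)
open import Data.List using (List; length)
open import Data.List.Membership.Propositional using (_∈_)
open import Data.List.Relation.Unary.AllPairs using (AllPairs)
open import Data.Product using (Σ; ∃; _×_; _,_)
open import Data.Sum using (_⊎_)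
open import Relation.Nullary using (¬_)
open import Relation.Binary.PropositionalEquality using (_≡_; _≢_)

Vertex : ℕ → Set
Vertex n = Vec Bool n

Adjacent : ∀ {n} → Vertex n → Vertex n → Set
Adjacent {n} u v =
  Σ (Fin n) λ i → (lookup u i ≢ lookup v i) ×
    (∀ j → j ≢ i → lookup u j ≡ lookup v j)

-- Represented by the map sending each vertex to the unique
-- vertex it is matched with: the edge {u , partner u} is in the matching,
-- the map is an involution (so the edge relation is symmetric and each
-- vertex lies in exactly one matching edge) and matched vertices are adjacent.
record PerfectMatching (n : ℕ) : Set where
  field
    partner     : Vertex n → Vertex n
    adjacent    : ∀ u → Adjacent u (partner u)
    involutive  : ∀ u → partner (partner u) ≡ u
open PerfectMatching public

Edge : ℕ → Set
Edge n = Vertex n × Vertex n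

_∈M_ : ∀ {n} → Edge n → PerfectMatching n → Set
(u , v) ∈M M = partner M u ≡ v

SameEdge : ∀ {n} → Edge n → Edge n → Set
SameEdge (a , b) (c , d) = (a ≡ c × b ≡ d) ⊎ (a ≡ d × b ≡ c)

SameMatching : ∀ {n} → PerfectMatching n → PerfectMatching n → Set
SameMatching M M′ = ∀ u → partner M u ≡ partner M′ u

IsForcingSet : ∀ {n} → PerfectMatching n → List (Edge n) → Set
IsForcingSet {n} M S =
  AllPairs (λ e f → ¬ SameEdge e f) S ×
  (∀ e → e ∈ S → e ∈M M) ×
  (∀ (M′ : PerfectMatching n) → (∀ e → e ∈ S → e ∈M M′) → SameMatching M′ M)

-- The size of a forcing set S is  length S  (entries are distinct edges).

module Submission where

-- Over 𝔽₄ pick nonzero weights wᵢ with Σ wᵢ² = 0 (all 1 for even n, and 1, ω, ω² followed by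
-- pairs of 1 for odd n).  In characteristic 2 the weighted neighbour sum N f (v) = Σ wᵢ f (v + eᵢ)
-- then satisfies N² = 0.  If S forces M, a function f : Q_n → 𝔽₄ is determined by the values of f
-- and N f at the 2|S| endpoints of S.  Otherwise, splitting the difference by parity and using
-- N² = 0 yields a nonzero function supported on uncovered vertices of one colour whose neighbour
-- sum vanishes on the uncovered vertices of the other colour; following its support produces an
-- M-alternating cycle avoiding S, and switching M along it contradicts forcing.  Counting the
-- functions gives 4 ^ 2ⁿ ≤ 4 ^ (4 |S|).

open import Defs
open import Level using (0ℓ)
open import Algebra.Bundles using (Semiring)
open import Algebra.Structures using (IsSemiring)
open import Algebra.Definitions
open import Data.Nat using (ℕ; zero; suc; _^_; _≤_; _<_; _∸_; z≤n; s≤s)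
import Data.Nat as ℕ
import Data.Nat.Properties as ℕₚ
open import Data.Nat.GeneralisedArithmetic using (fold; fold-+)
open import Data.Bool using (Bool; false; true; not; _xor_)
import Data.Bool as Bool
open import Data.Bool.Properties using (not-involutive; not-¬; ¬-not; not-distribˡ-xor; not-distribʳ-xor)
open import Data.Fin using (Fin; zero; suc; toℕ; fromℕ<; combine; funToFin; finToFun; punchIn)
  renaming (_≟_ to _≟ᶠ_)
open import Data.Fin.Properties
  using (2↔Bool; *↔×; pigeonhole; any?; toℕ-fromℕ<; injective⇒≤; funToFin-finToFin; finToFun-funToFin;
         punchInᵢ≢i)
open import Data.Fin.Patterns using (0F; 1F; 2F; 3F)
open import Data.Vec using (Vec; []; _∷_; lookup; updateAt)
open import Data.Vec.Properties
  using (≡-dec; updateAt-updateAt; updateAt-id-local; updateAt-commutes; lookup∘updateAt; lookup∘updateAt′;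
         tabulate∘lookup; tabulate-cong)
import Data.Vec.Functional as Vector
open import Data.List using (List; length)
import Data.List as List
open import Data.List.Membership.Propositional using (_∈_)
import Data.List.Relation.Unary.Any as Any
open import Data.List.Relation.Unary.Any.Properties using (lookup-index)
open import Data.Product using (Σ; ∃; ∃₂; _×_; _,_; proj₁; proj₂; uncurry)
open import Data.Product.Function.NonDependent.Propositional using (_×-↔_)
open import Data.Sum using (_⊎_; inj₁; inj₂)
open import Function using (_∘_; _↔_; _↣_; mk↔ₛ′; Inverse; Injection)
open import Function.Properties.Inverse using (↔-trans; ↔-sym; ↔⇒↣)
open import Relation.Nullary using (Dec; yes; no; ¬_; contradiction)
open import Relation.Nullary.Decidable using (from-yes; ¬?; _→-dec_; _×-dec_; map′; decidable-stable)
open import Relation.Unary using (Decidable)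
open import Relation.Binary.Definitions using (DecidableEquality)
open import Relation.Binary.PropositionalEquality
open import Relation.Binary.PropositionalEquality.Algebra using (isMagma)
open ≡-Reasoning

funToFin-cong : ∀ {m n} {f g : Fin m → Fin n} → f ≗ g → funToFin f ≡ funToFin g
funToFin-cong {zero} _ = refl
funToFin-cong {suc m} f≗g = cong₂ combine (f≗g zero) (funToFin-cong (f≗g ∘ suc))

Vec↔Fin^ : ∀ {A : Set} {q} n → A ↔ Fin q → Vec A n ↔ Fin (q ^ n)
Vec↔Fin^ zero _ = mk↔ₛ′ (λ _ → zero) (λ _ → []) (λ { zero → refl }) (λ { [] → refl })
Vec↔Fin^ {A} (suc n) A↔ = ↔-trans uncons↔ (↔-trans (A↔ ×-↔ Vec↔Fin^ n A↔) (↔-sym *↔×))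
  where
  uncons↔ : Vec A (suc n) ↔ (A × Vec A n)
  uncons↔ = mk↔ₛ′ (λ { (x ∷ xs) → x , xs }) (uncurry _∷_) (λ _ → refl) (λ { (x ∷ xs) → refl })

injective⇒^≤ : ∀ {X C D : Set} {m q r k} → X ↔ Fin m → C ↔ Fin q → D ↔ Fin r →
  (Φ : (X → C) → (Fin k → D)) → (∀ f g → Φ f ≗ Φ g → f ≗ g) → q ^ m ≤ r ^ k
injective⇒^≤ {X} {C} {m = m} {q} {r} {k} X↔ C↔ D↔ Φ Φ-injective = injective⇒≤ code-injective
  where
  open Inverse
  decode : Fin (q ^ m) → X → C
  decode x = from C↔ ∘ finToFun x ∘ to X↔
  code : Fin (q ^ m) → Fin (r ^ k)
  code x = funToFin (to D↔ ∘ Φ (decode x))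
  code-injective : ∀ {x y} → code x ≡ code y → x ≡ y
  code-injective {x} {y} eq = begin
    x                              ≡⟨ funToFin-finToFin {m} {q} x ⟨
    funToFin (finToFun {q} {m} x)  ≡⟨ funToFin-cong same-digits ⟩
    funToFin (finToFun {q} {m} y)  ≡⟨ funToFin-finToFin {m} {q} y ⟩
    y                              ∎
    where
    same-image : Φ (decode x) ≗ Φ (decode y)
    same-image j = Injection.injective (↔⇒↣ D↔) (begin
      to D↔ (Φ (decode x) j)  ≡⟨ finToFun-funToFin _ j ⟨
      finToFun (code x) j     ≡⟨ cong (λ c → finToFun c j) eq ⟩
      finToFun (code y) j     ≡⟨ finToFun-funToFin _ j ⟩
      to D↔ (Φ (decode y) j)  ∎)
    same-digits : finToFun {q} {m} x ≗ finToFun y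
    same-digits i = begin
      finToFun x i                    ≡⟨ cong (finToFun x) (strictlyInverseˡ X↔ i) ⟨
      finToFun x (to X↔ (from X↔ i))  ≡⟨ strictlyInverseˡ C↔ _ ⟨
      to C↔ (decode x (from X↔ i))    ≡⟨ cong (to C↔) (Φ-injective _ _ same-image (from X↔ i)) ⟩
      to C↔ (decode y (from X↔ i))    ≡⟨ strictlyInverseˡ C↔ _ ⟩
      finToFun y (to X↔ (from X↔ i))  ≡⟨ cong (finToFun y) (strictlyInverseˡ X↔ i) ⟩
      finToFun y i                    ∎

^-cancelˡ-≤ : ∀ m {a b} → 1 < m → m ^ a ≤ m ^ b → a ≤ b
^-cancelˡ-≤ m {a} {b} 1<m mᵃ≤mᵇ with a ℕₚ.≤? b
... | yes a≤b = a≤b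
... | no a≰b = contradiction (ℕₚ.^-monoʳ-< m 1<m (ℕₚ.≰⇒> a≰b)) (ℕₚ.≤⇒≯ mᵃ≤mᵇ)

2^n≤4*s⇒2^[n∸2]≤s : ∀ {n s} → 2 ≤ n → 2 ^ n ≤ 4 ℕ.* s → 2 ^ (n ∸ 2) ≤ s
2^n≤4*s⇒2^[n∸2]≤s {suc zero} (s≤s ())
2^n≤4*s⇒2^[n∸2]≤s {suc (suc n)} {s} _ 2ⁿ≤4s =
  ℕₚ.*-cancelˡ-≤ 4 (subst (_≤ 4 ℕ.* s) (sym (ℕₚ.*-assoc 2 2 (2 ^ n))) 2ⁿ≤4s)

-- Orbits of a self-map (fold x σ t is σᵗ x)

fold-preserves : ∀ {A : Set} {P : A → Set} {σ : A → A} → (∀ {v} → P v → P (σ v)) →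
  ∀ {x} → P x → ∀ t → P (fold x σ t)
fold-preserves P-σ Px zero = Px
fold-preserves {P = P} P-σ Px (suc t) = P-σ (fold-preserves {P = P} P-σ Px t)

eventually-periodic : ∀ {A : Set} {m} → A ↣ Fin m → (σ : A → A) (x : A) →
  ∃₂ λ t k → fold (fold x σ t) σ (suc k) ≡ fold x σ t
eventually-periodic {m = m} A↣ σ x
  with i , j , i<j , same-code ← pigeonhole (ℕₚ.n<1+n m) (Injection.to A↣ ∘ fold x σ ∘ toℕ {suc m})
  with k , i+1+k≡j ← ℕₚ.m≤n⇒∃[o]m+o≡n i<j
  = toℕ i , k , (begin
    fold (fold x σ (toℕ i)) σ (suc k)  ≡⟨ fold-+ x σ (suc k) ⟨
    fold x σ (suc k ℕ.+ toℕ i)         ≡⟨ cong (fold x σ ∘ suc) (ℕₚ.+-comm k (toℕ i)) ⟩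
    fold x σ (suc (toℕ i ℕ.+ k))       ≡⟨ cong (fold x σ) i+1+k≡j ⟩
    fold x σ (toℕ j)                   ≡⟨ Injection.injective A↣ same-code ⟨
    fold x σ (toℕ i)                   ∎)

module Orbit {A : Set} (_≟ᴬ_ : DecidableEquality A) (σ : A → A) (y : A) (k : ℕ)
             (period : fold y σ (suc k) ≡ y) where

  OnOrbit : A → Set
  OnOrbit v = ∃ λ t → fold y σ t ≡ v

  onOrbit-start : OnOrbit y
  onOrbit-start = 0 , refl

  onOrbit-σ : ∀ {v} → OnOrbit v → OnOrbit (σ v)
  onOrbit-σ (t , refl) = suc t , refl

  periodic : ∀ {v} → OnOrbit v → fold v σ (suc k) ≡ v
  periodic (t , refl) = begin
    fold (fold y σ t) σ (suc k)  ≡⟨ fold-+ y σ (suc k) ⟨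
    fold y σ (suc k ℕ.+ t)       ≡⟨ cong (fold y σ) (ℕₚ.+-comm (suc k) t) ⟩
    fold y σ (t ℕ.+ suc k)       ≡⟨ fold-+ y σ t ⟩
    fold (fold y σ (suc k)) σ t  ≡⟨ cong (λ z → fold z σ t) period ⟩
    fold y σ t                   ∎

  σ⁻¹ : A → A
  σ⁻¹ v = fold v σ k

  onOrbit-σ⁻¹ : ∀ {v} → OnOrbit v → OnOrbit (σ⁻¹ v)
  onOrbit-σ⁻¹ (t , refl) = k ℕ.+ t , fold-+ y σ k

  σ-σ⁻¹ : ∀ {v} → OnOrbit v → σ (σ⁻¹ v) ≡ v
  σ-σ⁻¹ = periodic

  σ⁻¹-σ : ∀ {v} → OnOrbit v → σ⁻¹ (σ v) ≡ v
  σ⁻¹-σ {v} on = trans (trans (sym (fold-+ v σ k)) (cong (fold v σ) (ℕₚ.+-comm k 1))) (periodic on)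

  onOrbit-bounded : ∀ t → ∃ λ s → s ≤ k × fold y σ s ≡ fold y σ t
  onOrbit-bounded zero = 0 , z≤n , refl
  onOrbit-bounded (suc t) with s , s≤k , eq ← onOrbit-bounded t with ℕₚ.m≤n⇒m<n∨m≡n s≤k
  ... | inj₁ s<k = suc s , s<k , cong σ eq
  ... | inj₂ refl = 0 , z≤n , trans (sym period) (cong σ eq)

  onOrbit? : Decidable OnOrbit
  onOrbit? v = map′ (λ (s , eq) → toℕ s , eq) within-period (any? λ s → fold y σ (toℕ s) ≟ᴬ v)
    where
    within-period : OnOrbit v → ∃ λ (s : Fin (suc k)) → fold y σ (toℕ s) ≡ v
    within-period (t , refl) with s , s≤k , eq ← onOrbit-bounded t
      = fromℕ< (s≤s s≤k) , trans (cong (fold y σ) (toℕ-fromℕ< (s≤s s≤k))) eq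

-- The field with four elements

data 𝔽₄ : Set where
  0# 1# ω ω² : 𝔽₄

infixl 6 _+_
infixl 7 _*_
infix 4 _≟_

_+_ : 𝔽₄ → 𝔽₄ → 𝔽₄
0# + y  = y
x  + 0# = x
1# + 1# = 0#
1# + ω  = ω²
1# + ω² = ω
ω  + 1# = ω²
ω  + ω  = 0#
ω  + ω² = 1#
ω² + 1# = ω
ω² + ω  = 1#
ω² + ω² = 0#

_*_ : 𝔽₄ → 𝔽₄ → 𝔽₄
0# * _  = 0#
1# * y  = y
ω  * 0# = 0#
ω  * 1# = ω
ω  * ω  = ω²
ω  * ω² = 1#
ω² * 0# = 0#
ω² * 1# = ω²
ω² * ω  = 1#
ω² * ω² = ω

_≟_ : DecidableEquality 𝔽₄
0# ≟ 0# = yes refl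
1# ≟ 1# = yes refl
ω  ≟ ω  = yes refl
ω² ≟ ω² = yes refl
0# ≟ 1# = no λ ()
0# ≟ ω  = no λ ()
0# ≟ ω² = no λ ()
1# ≟ 0# = no λ ()
1# ≟ ω  = no λ ()
1# ≟ ω² = no λ ()
ω  ≟ 0# = no λ ()
ω  ≟ 1# = no λ ()
ω  ≟ ω² = no λ ()
ω² ≟ 0# = no λ ()
ω² ≟ 1# = no λ ()
ω² ≟ ω  = no λ ()

𝔽₄↔Fin4 : 𝔽₄ ↔ Fin 4
𝔽₄↔Fin4 = mk↔ₛ′
  (λ { 0# → 0F ; 1# → 1F ; ω → 2F ; ω² → 3F })
  (λ { 0F → 0# ; 1F → 1# ; 2F → ω ; 3F → ω² })
  (λ { 0F → refl ; 1F → refl ; 2F → refl ; 3F → refl })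
  (λ { 0# → refl ; 1# → refl ; ω → refl ; ω² → refl })

∀? : {P : 𝔽₄ → Set} → (∀ x → Dec (P x)) → Dec (∀ x → P x)
∀? P? with P? 0# | P? 1# | P? ω | P? ω²
... | yes p₀ | yes p₁ | yes p₂ | yes p₃ = yes λ { 0# → p₀ ; 1# → p₁ ; ω → p₂ ; ω² → p₃ }
... | no ¬p  | _     | _     | _     = no λ p → ¬p (p 0#)
... | yes _  | no ¬p | _     | _     = no λ p → ¬p (p 1#)
... | yes _  | yes _ | no ¬p | _     = no λ p → ¬p (p ω)
... | yes _  | yes _ | yes _ | no ¬p = no λ p → ¬p (p ω²)

+-assoc : Associative _≡_ _+_
+-assoc = from-yes (∀? λ x → ∀? λ y → ∀? λ z → x + y + z ≟ x + (y + z))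

+-comm : Commutative _≡_ _+_
+-comm = from-yes (∀? λ x → ∀? λ y → x + y ≟ y + x)

+-identityʳ : RightIdentity _≡_ 0# _+_
+-identityʳ = from-yes (∀? λ x → x + 0# ≟ x)

x+x≡0 : ∀ x → x + x ≡ 0#
x+x≡0 = from-yes (∀? λ x → x + x ≟ 0#)

x+y≡0⇒x≡y : ∀ x y → x + y ≡ 0# → x ≡ y
x+y≡0⇒x≡y = from-yes (∀? λ x → ∀? λ y → x + y ≟ 0# →-dec x ≟ y)

+-cancel-middle : ∀ x y z → (x + y) + (y + z) ≡ x + z
+-cancel-middle = from-yes (∀? λ x → ∀? λ y → ∀? λ z → (x + y) + (y + z) ≟ x + z)

*-assoc : Associative _≡_ _*_
*-assoc = from-yes (∀? λ x → ∀? λ y → ∀? λ z → x * y * z ≟ x * (y * z))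

*-comm : Commutative _≡_ _*_
*-comm = from-yes (∀? λ x → ∀? λ y → x * y ≟ y * x)

*-identityʳ : RightIdentity _≡_ 1# _*_
*-identityʳ = from-yes (∀? λ x → x * 1# ≟ x)

*-zeroʳ : RightZero _≡_ 0# _*_
*-zeroʳ = from-yes (∀? λ x → x * 0# ≟ 0#)

*-distribˡ-+ : _DistributesOverˡ_ _≡_ _*_ _+_
*-distribˡ-+ = from-yes (∀? λ x → ∀? λ y → ∀? λ z → x * (y + z) ≟ x * y + x * z)

*-distribʳ-+ : _DistributesOverʳ_ _≡_ _*_ _+_
*-distribʳ-+ = from-yes (∀? λ x → ∀? λ y → ∀? λ z → (y + z) * x ≟ y * x + z * x)

*-nonzero : ∀ x y → x ≢ 0# → y ≢ 0# → x * y ≢ 0#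
*-nonzero = from-yes (∀? λ x → ∀? λ y → ¬? (x ≟ 0#) →-dec ¬? (y ≟ 0#) →-dec ¬? (x * y ≟ 0#))

+-*-isSemiring : IsSemiring _≡_ _+_ _*_ 0# 1#
+-*-isSemiring = record
  { isSemiringWithoutAnnihilatingZero = record
    { +-isCommutativeMonoid = record
      { isMonoid = record
        { isSemigroup = record { isMagma = isMagma _+_ ; assoc = +-assoc }
        ; identity = (λ _ → refl) , +-identityʳ
        }
      ; comm = +-comm
      }
    ; *-cong = cong₂ _*_
    ; *-assoc = *-assoc
    ; *-identity = (λ _ → refl) , *-identityʳ
    ; distrib = *-distribˡ-+ , *-distribʳ-+
    }
  ; zero = (λ _ → refl) , *-zeroʳ
  }

+-*-semiring : Semiring 0ℓ 0ℓ
+-*-semiring = record { isSemiring = +-*-isSemiring }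

open import Algebra.Properties.Semiring.Sum +-*-semiring
  using (sum; sum-syntax; sum-cong-≗; ∑-distrib-+; *-distribˡ-sum; *-distribʳ-sum; sum-remove; sum-replicate-zero)

∑-symmetric : ∀ {n} (a : Fin n → Fin n → 𝔽₄) → (∀ i j → a i j ≡ a j i) →
  ∑[ i < n ] ∑[ j < n ] a i j ≡ ∑[ i < n ] a i i
∑-symmetric {zero} a _ = refl
∑-symmetric {suc n} a a-sym = begin
  a zero zero + row + ∑[ i < n ] (a (suc i) zero + ∑[ j < n ] a (suc i) (suc j))
    ≡⟨ cong (a zero zero + row +_) (∑-distrib-+ (λ i → a (suc i) zero) _) ⟩
  a zero zero + row + (∑[ i < n ] a (suc i) zero + rest)
    ≡⟨ cong (λ c → a zero zero + row + (c + rest)) (sum-cong-≗ (λ i → a-sym (suc i) zero)) ⟩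
  a zero zero + row + (row + rest)
    ≡⟨ +-cancel-middle (a zero zero) row rest ⟩
  a zero zero + rest
    ≡⟨ cong (a zero zero +_) (∑-symmetric (λ i j → a (suc i) (suc j)) (λ i j → a-sym (suc i) (suc j))) ⟩
  a zero zero + ∑[ i < n ] a (suc i) (suc i) ∎
  where
  row rest : 𝔽₄
  row = ∑[ j < n ] a zero (suc j)
  rest = ∑[ i < n ] ∑[ j < n ] a (suc i) (suc j)

∑-single : ∀ {n} (g : Fin n → 𝔽₄) i → (∀ j → j ≢ i → g j ≡ 0#) → ∑[ j < n ] g j ≡ g i
∑-single {suc n} g i g-vanishes = begin
  sum g                            ≡⟨ sum-remove {i = i} g ⟩
  g i + sum (Vector.removeAt g i)  ≡⟨ cong (g i +_) (sum-cong-≗ {n} λ k → g-vanishes _ (punchInᵢ≢i i k)) ⟩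
  g i + sum {n} (λ _ → 0#)         ≡⟨ cong (g i +_) (sum-replicate-zero n) ⟩
  g i + 0#                         ≡⟨ +-identityʳ (g i) ⟩
  g i                              ∎

toggle : ∀ {n} → Fin n → Vertex n → Vertex n
toggle i v = updateAt v i not

_≟ᵛ_ : ∀ {n} → DecidableEquality (Vertex n)
_≟ᵛ_ = ≡-dec Bool._≟_

Vertex↔Fin : ∀ {n} → Vertex n ↔ Fin (2 ^ n)
Vertex↔Fin {n} = Vec↔Fin^ n (↔-sym 2↔Bool)

lookup-extensional : ∀ {A : Set} {n} {u v : Vec A n} → lookup u ≗ lookup v → u ≡ v
lookup-extensional {u = u} {v} eq = trans (sym (tabulate∘lookup u)) (trans (tabulate-cong eq) (tabulate∘lookup v))

toggle-involutive : ∀ {n} (i : Fin n) v → toggle i (toggle i v) ≡ v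
toggle-involutive i v = trans (updateAt-updateAt i v) (updateAt-id-local i v (not-involutive _))

toggle-comm : ∀ {n} (i j : Fin n) v → toggle i (toggle j v) ≡ toggle j (toggle i v)
toggle-comm i j v with i ≟ᶠ j
... | yes refl = refl
... | no i≢j = updateAt-commutes i j i≢j v

toggle-injective : ∀ {n} {i j : Fin n} v → toggle i v ≡ toggle j v → i ≡ j
toggle-injective {i = i} {j} v eq with i ≟ᶠ j
... | yes i≡j = i≡j
... | no i≢j = contradiction (begin
  lookup v i              ≡⟨ lookup∘updateAt′ i j i≢j v ⟨
  lookup (toggle j v) i   ≡⟨ cong (λ u → lookup u i) eq ⟨
  lookup (toggle i v) i   ≡⟨ lookup∘updateAt i v ⟩
  not (lookup v i)        ∎) (not-¬ refl)

toggle-adjacent : ∀ {n} (i : Fin n) v → Adjacent v (toggle i v)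
toggle-adjacent i v =
  i , (λ eq → not-¬ refl (trans eq (lookup∘updateAt i v))) , λ j j≢i → sym (lookup∘updateAt′ j i j≢i v)

adjacent⇒toggle : ∀ {n} {u v : Vertex n} (a : Adjacent u v) → v ≡ toggle (proj₁ a) u
adjacent⇒toggle {u = u} {v} (i , uᵢ≢vᵢ , rest) = lookup-extensional agree
  where
  agree : ∀ j → lookup v j ≡ lookup (toggle i u) j
  agree j with j ≟ᶠ i
  ... | yes refl = trans (¬-not (uᵢ≢vᵢ ∘ sym)) (sym (lookup∘updateAt i u))
  ... | no j≢i = trans (sym (rest j j≢i)) (sym (lookup∘updateAt′ j i j≢i u))

Adjacent-sym : ∀ {n} {u v : Vertex n} → Adjacent u v → Adjacent v u
Adjacent-sym (i , uᵢ≢vᵢ , rest) = i , uᵢ≢vᵢ ∘ sym , λ j j≢i → sym (rest j j≢i)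

parity : ∀ {n} → Vertex n → Bool
parity [] = false
parity (x ∷ xs) = x xor parity xs

parity-toggle : ∀ {n} (i : Fin n) v → parity (toggle i v) ≡ not (parity v)
parity-toggle zero    (x ∷ xs) = sym (not-distribˡ-xor x (parity xs))
parity-toggle (suc i) (x ∷ xs) = trans (cong (x xor_) (parity-toggle i xs)) (sym (not-distribʳ-xor x (parity xs)))

parity-adjacent : ∀ {n} {u v : Vertex n} → Adjacent u v → parity v ≡ not (parity u)
parity-adjacent {u = u} {v} a = trans (cong parity (adjacent⇒toggle {u = u} {v} a)) (parity-toggle (proj₁ a) u)

-- Weighted neighbour sums

record Balanced {n} (w : Fin n → 𝔽₄) : Set where
  field
    nonzero : ∀ i → w i ≢ 0#
    squares : ∑[ i < n ] (w i * w i) ≡ 0#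

Balanced-∷ : ∀ {n} {w : Fin n → 𝔽₄} → Balanced w → Balanced (1# Vector.∷ 1# Vector.∷ w)
Balanced-∷ w-balanced = record
  { nonzero = λ { zero → λ () ; (suc zero) → λ () ; (suc (suc i)) → Balanced.nonzero w-balanced i }
  ; squares = trans (1+1+x≡x _) (Balanced.squares w-balanced)
  }
  where
  1+1+x≡x : ∀ x → 1# + (1# + x) ≡ x
  1+1+x≡x = from-yes (∀? λ x → 1# + (1# + x) ≟ x)

balanced : ∀ n → n ≢ 1 → Σ (Fin n → 𝔽₄) Balanced
balanced zero _ = (λ ()) , record { nonzero = λ () ; squares = refl }
balanced (suc zero) n≢1 = contradiction refl n≢1
balanced (suc (suc zero)) _ = _ , Balanced-∷ (proj₂ (balanced zero λ ()))
balanced (suc (suc (suc zero))) _ = (1# Vector.∷ ω Vector.∷ ω² Vector.∷ λ ()) , record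
  { nonzero = λ { zero → λ () ; (suc zero) → λ () ; (suc (suc zero)) → λ () }
  ; squares = refl
  }
balanced (suc (suc (suc (suc n)))) _ = _ , Balanced-∷ (proj₂ (balanced (suc (suc n)) λ ()))

neighbourSum : ∀ {n} → (Fin n → 𝔽₄) → (Vertex n → 𝔽₄) → Vertex n → 𝔽₄
neighbourSum {n} w f v = ∑[ i < n ] (w i * f (toggle i v))

module _ {n} (w : Fin n → 𝔽₄) where

  neighbourSum-cong : ∀ {f g} → f ≗ g → neighbourSum w f ≗ neighbourSum w g
  neighbourSum-cong f≗g v = sum-cong-≗ (λ i → cong (w i *_) (f≗g (toggle i v)))

  neighbourSum-+ : ∀ f g v → neighbourSum w (λ u → f u + g u) v ≡ neighbourSum w f v + neighbourSum w g v
  neighbourSum-+ f g v = trans (sum-cong-≗ (λ i → *-distribˡ-+ (w i) (f (toggle i v)) (g (toggle i v))))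
    (∑-distrib-+ (λ i → w i * f (toggle i v)) (λ i → w i * g (toggle i v)))

  neighbourSum-zero : ∀ f v → (∀ i → f (toggle i v) ≡ 0#) → neighbourSum w f v ≡ 0#
  neighbourSum-zero f v f-vanishes =
    trans (sum-cong-≗ (λ i → trans (cong (w i *_) (f-vanishes i)) (*-zeroʳ (w i)))) (sum-replicate-zero n)

  neighbourSum-single : ∀ f v i → (∀ j → j ≢ i → f (toggle j v) ≡ 0#) →
    neighbourSum w f v ≡ w i * f (toggle i v)
  neighbourSum-single f v i f-vanishes =
    ∑-single _ i (λ j j≢i → trans (cong (w j *_) (f-vanishes j j≢i)) (*-zeroʳ (w j)))

  neighbourSum² : ∑[ i < n ] (w i * w i) ≡ 0# → ∀ f v → neighbourSum w (neighbourSum w f) v ≡ 0#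
  neighbourSum² squares f v = begin
    ∑[ i < n ] (w i * ∑[ j < n ] (w j * f (toggle j (toggle i v))))
      ≡⟨ sum-cong-≗ (λ i → *-distribˡ-sum (w i) (λ j → w j * f (toggle j (toggle i v)))) ⟩
    ∑[ i < n ] ∑[ j < n ] a i j
      ≡⟨ ∑-symmetric a a-symmetric ⟩
    ∑[ i < n ] a i i
      ≡⟨ sum-cong-≗ (λ i → trans (sym (*-assoc (w i) (w i) _))
                                 (cong (λ u → w i * w i * f u) (toggle-involutive i v))) ⟩
    ∑[ i < n ] (w i * w i * f v)
      ≡⟨ *-distribʳ-sum (f v) (λ i → w i * w i) ⟨
    ∑[ i < n ] (w i * w i) * f v
      ≡⟨ cong (_* f v) squares ⟩
    0# ∎
    where
    a : Fin n → Fin n → 𝔽₄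
    a i j = w i * (w j * f (toggle j (toggle i v)))
    a-symmetric : ∀ i j → a i j ≡ a j i
    a-symmetric i j = begin
      w i * (w j * f (toggle j (toggle i v)))  ≡⟨ *-assoc (w i) (w j) _ ⟨
      w i * w j * f (toggle j (toggle i v))    ≡⟨ cong₂ _*_ (*-comm (w i) (w j)) (cong f (toggle-comm j i v)) ⟩
      w j * w i * f (toggle i (toggle j v))    ≡⟨ *-assoc (w j) (w i) _ ⟩
      w j * (w i * f (toggle i (toggle j v)))  ∎

onParity : ∀ {n} → Bool → (Vertex n → 𝔽₄) → Vertex n → 𝔽₄
onParity b f v with parity v Bool.≟ b
... | yes _ = f v
... | no _ = 0#

module _ {n} (f : Vertex n → 𝔽₄) where

  onParity-split : ∀ b v → onParity b f v + onParity (not b) f v ≡ f v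
  onParity-split b v with parity v Bool.≟ b | parity v Bool.≟ not b
  ... | yes _   | no _     = +-identityʳ (f v)
  ... | no _    | yes _    = refl
  ... | yes p≡b | yes p≡¬b = contradiction (trans (sym p≡b) p≡¬b) (not-¬ refl)
  ... | no p≢b  | no p≢¬b  = contradiction (¬-not p≢b) p≢¬b

  onParity-support : ∀ b v → onParity b f v ≢ 0# → parity v ≡ b × f v ≢ 0#
  onParity-support b v nz with parity v Bool.≟ b
  ... | yes p≡b = p≡b , nz
  ... | no _ = contradiction refl nz

  neighbourSum-onParity-same : ∀ b w v → parity v ≡ b → neighbourSum w (onParity b f) v ≡ 0#
  neighbourSum-onParity-same b w v p≡b = neighbourSum-zero w (onParity b f) v off
    where
    off : ∀ i → onParity b f (toggle i v) ≡ 0#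
    off i with parity (toggle i v) Bool.≟ b
    ... | yes eq = contradiction (trans p≡b (sym (trans (sym (parity-toggle i v)) eq))) (not-¬ refl)
    ... | no _ = refl

  neighbourSum-onParity-other : ∀ b w v → parity v ≡ not b →
    neighbourSum w (onParity b f) v ≡ neighbourSum w f v
  neighbourSum-onParity-other b w v p≡¬b = begin
    neighbourSum w g v                                          ≡⟨ +-identityʳ _ ⟨
    neighbourSum w g v + 0#                                     ≡⟨ cong (neighbourSum w g v +_) g′-vanishes ⟨
    neighbourSum w g v + neighbourSum w (onParity (not b) f) v  ≡⟨ neighbourSum-+ w g (onParity (not b) f) v ⟨
    neighbourSum w (λ u → g u + onParity (not b) f u) v         ≡⟨ neighbourSum-cong w (onParity-split b) v ⟩
    neighbourSum w f v                                          ∎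
    where
    g : Vertex n → 𝔽₄
    g = onParity b f
    g′-vanishes : neighbourSum w (onParity (not b) f) v ≡ 0#
    g′-vanishes = neighbourSum-onParity-same (not b) w v p≡¬b

partner-toggle : ∀ {n} (M : PerfectMatching n) v → partner M v ≡ toggle (proj₁ (adjacent M v)) v
partner-toggle M v = adjacent⇒toggle {u = v} {partner M v} (adjacent M v)

parity-partner : ∀ {n} (M : PerfectMatching n) v → parity (partner M v) ≡ not (parity v)
parity-partner M v = parity-adjacent {u = v} {partner M v} (adjacent M v)

-- M is switched along the alternating cycles  v , p (σ v) , σ v , …  through the vertices v ∈ C.
module Switch {n} (M : PerfectMatching n) {C : Vertex n → Set} (C? : Decidable C)
  (σ τ : Vertex n → Vertex n)
  (C-σ : ∀ {v} → C v → C (σ v)) (C-τ : ∀ {v} → C v → C (τ v))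
  (σ-τ : ∀ {v} → C v → σ (τ v) ≡ v) (τ-σ : ∀ {v} → C v → τ (σ v) ≡ v)
  (C-independent : ∀ {v} → C v → ¬ C (partner M v))
  (adjacent-σ : ∀ {v} → C v → Adjacent v (partner M (σ v))) where

  private
    p : Vertex n → Vertex n
    p = partner M

  switchedPartner : Vertex n → Vertex n
  switchedPartner v with C? v | C? (p v)
  ... | yes _ | _     = p (σ v)
  ... | no _  | yes _ = τ (p v)
  ... | no _  | no _  = p v

  switched-on : ∀ {v} → C v → switchedPartner v ≡ p (σ v)
  switched-on {v} c with C? v | C? (p v)
  ... | yes _ | _ = refl
  ... | no ¬c | _ = contradiction c ¬c

  switched-partner-on : ∀ {v} → ¬ C v → C (p v) → switchedPartner v ≡ τ (p v)
  switched-partner-on {v} ¬c c′ with C? v | C? (p v)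
  ... | yes c | _      = contradiction c ¬c
  ... | no _  | yes _  = refl
  ... | no _  | no ¬c′ = contradiction c′ ¬c′

  switched-off : ∀ {v} → ¬ C v → ¬ C (p v) → switchedPartner v ≡ p v
  switched-off {v} ¬c ¬c′ with C? v | C? (p v)
  ... | yes c | _      = contradiction c ¬c
  ... | no _  | yes c′ = contradiction c′ ¬c′
  ... | no _  | no _   = refl

  switched-involutive : ∀ v → switchedPartner (switchedPartner v) ≡ v
  switched-involutive v with C? v | C? (p v)
  ... | yes c | _ = begin
    switchedPartner (p (σ v))  ≡⟨ switched-partner-on (λ c′ → C-independent c′ Cσv) Cσv ⟩
    τ (p (p (σ v)))            ≡⟨ cong τ (involutive M (σ v)) ⟩
    τ (σ v)                    ≡⟨ τ-σ c ⟩
    v                          ∎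
    where
    Cσv : C (p (p (σ v)))
    Cσv = subst C (sym (involutive M (σ v))) (C-σ c)
  ... | no ¬c | yes c′ = begin
    switchedPartner (τ (p v))  ≡⟨ switched-on (C-τ c′) ⟩
    p (σ (τ (p v)))            ≡⟨ cong p (σ-τ c′) ⟩
    p (p v)                    ≡⟨ involutive M v ⟩
    v                          ∎
  ... | no ¬c | no ¬c′ = begin
    switchedPartner (p v)      ≡⟨ switched-off ¬c′ (¬c ∘ subst C (involutive M v)) ⟩
    p (p v)                    ≡⟨ involutive M v ⟩
    v                          ∎

  switched-adjacent : ∀ v → Adjacent v (switchedPartner v)
  switched-adjacent v with C? v | C? (p v)
  ... | yes c | _ = adjacent-σ c
  ... | no ¬c | yes c′ = Adjacent-sym {u = τ (p v)} {v}
    (subst (Adjacent (τ (p v))) (trans (cong p (σ-τ c′)) (involutive M v)) (adjacent-σ (C-τ c′)))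
  ... | no ¬c | no ¬c′ = adjacent M v

  switched : PerfectMatching n
  switched = record
    { partner = switchedPartner
    ; adjacent = switched-adjacent
    ; involutive = switched-involutive
    }

module ForcingSet {n} (M : PerfectMatching n) (S : List (Edge n))
  (S⊆M : ∀ e → e ∈ S → e ∈M M)
  (forces : ∀ M′ → (∀ e → e ∈ S → e ∈M M′) → SameMatching M′ M) where

  private
    p : Vertex n → Vertex n
    p = partner M

  Covered : Vertex n → Set
  Covered v = ∃ λ e → e ∈ S × (proj₁ e ≡ v ⊎ proj₂ e ≡ v)

  covered-partner : ∀ {v} → Covered v → Covered (p v)
  covered-partner (e , e∈S , inj₁ refl) = e , e∈S , inj₂ (sym (S⊆M e e∈S))
  covered-partner (e , e∈S , inj₂ refl) = e , e∈S , inj₁ (trans (sym (involutive M _)) (cong p (S⊆M e e∈S)))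

  Free : Bool → Vertex n → Set
  Free b v = ¬ Covered v × parity v ≡ b

  module AlternatingWalk {w : Fin n → 𝔽₄} (w-nonzero : ∀ i → w i ≢ 0#)
    (b : Bool) (f : Vertex n → 𝔽₄)
    (support : ∀ v → f v ≢ 0# → Free b v)
    (harmonic : ∀ z → Free (not b) z → neighbourSum w f z ≡ 0#) where

    Active : Vertex n → Set
    Active z = f (p z) ≢ 0#

    active-free : ∀ {z} → Active z → Free (not b) z
    active-free {z} a with pz-free , pz-parity ← support (p z) a =
      pz-free ∘ covered-partner ,
      trans (sym (not-involutive _)) (cong not (trans (sym (parity-partner M z)) pz-parity))

    active-partner : ∀ {z} → Active z → ¬ Active (p z)
    active-partner {z} a a′ = not-¬ refl (begin
      parity z        ≡⟨ proj₂ (active-free a) ⟩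
      not b           ≡⟨ proj₂ (active-free a′) ⟨
      parity (p z)    ≡⟨ parity-partner M z ⟩
      not (parity z)  ∎)

    next : Vertex n → Vertex n
    next z with any? (λ j → ¬? (toggle j z ≟ᵛ p z) ×-dec ¬? (f (toggle j z) ≟ 0#))
    ... | yes (j , _) = p (toggle j z)
    ... | no _ = z

    partner-next : ∀ {z} → Active z →
      ∃ λ j → (toggle j z ≢ p z × f (toggle j z) ≢ 0#) × p (next z) ≡ toggle j z
    partner-next {z} a with any? (λ j → ¬? (toggle j z ≟ᵛ p z) ×-dec ¬? (f (toggle j z) ≟ 0#))
    ... | yes (j , found) = j , found , involutive M (toggle j z)
    -- Otherwise neighbourSum w f z would be the single nonzero term w i * f (p z).
    ... | no none =
      contradiction (trans (sym single-term) (harmonic z (active-free a))) (*-nonzero (w i) _ (w-nonzero i) a)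
      where
      i : Fin n
      i = proj₁ (adjacent M z)
      others-vanish : ∀ j → j ≢ i → f (toggle j z) ≡ 0#
      others-vanish j j≢i = decidable-stable (f (toggle j z) ≟ 0#) λ fj≢0 →
        none (j , (λ eq → j≢i (toggle-injective z (trans eq (partner-toggle M z)))) , fj≢0)
      single-term : neighbourSum w f z ≡ w i * f (p z)
      single-term = trans (neighbourSum-single w f z i others-vanish)
                          (cong (λ u → w i * f u) (sym (partner-toggle M z)))

    active-next : ∀ {z} → Active z → Active (next z)
    active-next a with j , (_ , fj≢0) , eq ← partner-next a = fj≢0 ∘ subst (λ u → f u ≡ 0#) eq

    adjacent-next : ∀ {z} → Active z → Adjacent z (p (next z))
    adjacent-next {z} a with j , _ , eq ← partner-next a = subst (Adjacent z) (sym eq) (toggle-adjacent j z)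

    next-moves : ∀ {z} → Active z → p (next z) ≢ p z
    next-moves a with j , (j≢p , _) , eq ← partner-next a = j≢p ∘ trans (sym eq)

    -- The orbit of a periodic point of next is an alternating cycle avoiding S: switching M along
    -- it gives a second perfect matching containing S.
    no-active : ∀ {z} → ¬ Active z
    no-active {z} a with t , k , period ← eventually-periodic (↔⇒↣ Vertex↔Fin) next z =
      next-moves (onOrbit-active onOrbit-start)
        (trans (sym (switched-on onOrbit-start)) (forces switched S⊆switched _))
      where
      open Orbit _≟ᵛ_ next (fold z next t) k period
      onOrbit-active : ∀ {u} → OnOrbit u → Active u
      onOrbit-active (s , refl) =
        fold-preserves {P = Active} active-next (fold-preserves {P = Active} active-next a t) s
      open Switch M onOrbit? next σ⁻¹ onOrbit-σ onOrbit-σ⁻¹ σ-σ⁻¹ σ⁻¹-σ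
        (λ c c′ → active-partner (onOrbit-active c) (onOrbit-active c′)) (adjacent-next ∘ onOrbit-active)
      uncovered : ∀ {u} → OnOrbit u → ¬ Covered u
      uncovered = proj₁ ∘ active-free ∘ onOrbit-active
      S⊆switched : ∀ e → e ∈ S → e ∈M switched
      S⊆switched e e∈S =
        trans (switched-off (λ c → uncovered c cov) (λ c → uncovered c (covered-partner cov))) (S⊆M e e∈S)
        where
        cov : Covered (proj₁ e)
        cov = e , e∈S , inj₁ refl

    vanishes : ∀ v → f v ≡ 0#
    vanishes v = decidable-stable (f v ≟ 0#) λ fv≢0 →
      no-active (subst (λ u → f u ≢ 0#) (sym (involutive M v)) fv≢0)

  free-support-vanishes : ∀ {w : Fin n → 𝔽₄} → (∀ i → w i ≢ 0#) → ∀ b f →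
    (∀ v → f v ≢ 0# → Free b v) → (∀ z → Free (not b) z → neighbourSum w f z ≡ 0#) → f ≗ λ _ → 0#
  free-support-vanishes w-nonzero b f support harmonic = AlternatingWalk.vanishes w-nonzero b f support harmonic

  module _ {w : Fin n → 𝔽₄} (w-balanced : Balanced w) where

    open Balanced w-balanced

    vanishes-on-covered⇒vanishes : ∀ d → (∀ v → Covered v → d v ≡ 0# × neighbourSum w d v ≡ 0#) →
      d ≗ λ _ → 0#
    vanishes-on-covered⇒vanishes d d-covered v = begin
      d v                                     ≡⟨ onParity-split d false v ⟨
      onParity false d v + onParity true d v  ≡⟨ cong₂ _+_ (part-vanishes false v) (part-vanishes true v) ⟩
      0#                                      ∎
      where
      -- N g is supported on free vertices of the other parity and N (N g) = 0, so N g = 0; then g = 0.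
      part-vanishes : ∀ b → onParity b d ≗ λ _ → 0#
      part-vanishes b = free-support-vanishes nonzero b g g-support (λ z _ → Ng-vanishes z)
        where
        g : Vertex n → 𝔽₄
        g = onParity b d
        Ng-support : ∀ u → neighbourSum w g u ≢ 0# → Free (not b) u
        Ng-support u nz with parity u Bool.≟ b
        ... | yes pu≡b = contradiction (neighbourSum-onParity-same d b w u pu≡b) nz
        ... | no pu≢b =
          (λ cov → nz (trans (neighbourSum-onParity-other d b w u (¬-not pu≢b)) (proj₂ (d-covered u cov)))) ,
          ¬-not pu≢b
        Ng-vanishes : ∀ u → neighbourSum w g u ≡ 0#
        Ng-vanishes =
          free-support-vanishes nonzero (not b) (neighbourSum w g) Ng-support (λ z _ → neighbourSum² w squares g z)
        g-support : ∀ u → g u ≢ 0# → Free b u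
        g-support u nz with pu≡b , du≢0 ← onParity-support d b u nz = du≢0 ∘ proj₁ ∘ d-covered u , pu≡b

    observeEdge : (Vertex n → 𝔽₄) → Edge n → Vec 𝔽₄ 4
    observeEdge f (a , a′) = f a ∷ neighbourSum w f a ∷ f a′ ∷ neighbourSum w f a′ ∷ []

    observe : (Vertex n → 𝔽₄) → Fin (length S) → Vec 𝔽₄ 4
    observe f i = observeEdge f (List.lookup S i)

    observe-covered : ∀ f g → observe f ≗ observe g →
      ∀ v → Covered v → f v ≡ g v × neighbourSum w f v ≡ neighbourSum w g v
    observe-covered f g same v (e , e∈S , endpoint) = at endpoint
      where
      same-e : observeEdge f e ≡ observeEdge g e
      same-e = subst (λ x → observeEdge f x ≡ observeEdge g x) (sym (lookup-index e∈S)) (same (Any.index e∈S))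
      at : proj₁ e ≡ v ⊎ proj₂ e ≡ v → f v ≡ g v × neighbourSum w f v ≡ neighbourSum w g v
      at (inj₁ refl) = cong (λ o → lookup o 0F) same-e , cong (λ o → lookup o 1F) same-e
      at (inj₂ refl) = cong (λ o → lookup o 2F) same-e , cong (λ o → lookup o 3F) same-e

    observe-injective : ∀ f g → observe f ≗ observe g → f ≗ g
    observe-injective f g same v = x+y≡0⇒x≡y (f v) (g v) (vanishes-on-covered⇒vanishes d d-covered v)
      where
      d : Vertex n → 𝔽₄
      d u = f u + g u
      d-covered : ∀ u → Covered u → d u ≡ 0# × neighbourSum w d u ≡ 0#
      d-covered u cov with fu≡gu , Nfu≡Ngu ← observe-covered f g same u cov =
        trans (cong (_+ g u) fu≡gu) (x+x≡0 (g u)) ,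
        trans (neighbourSum-+ w f g u) (trans (cong (_+ neighbourSum w g u) Nfu≡Ngu) (x+x≡0 (neighbourSum w g u)))

mainTheorem1 : (n : ℕ) → 2 ≤ n → (M : PerfectMatching n) →
    (S : List (Edge n)) → IsForcingSet M S → 2 ^ (n ∸ 2) ≤ length S
mainTheorem1 n 2≤n M S (_ , S⊆M , forces) =
  2^n≤4*s⇒2^[n∸2]≤s 2≤n (^-cancelˡ-≤ 4 (s≤s (s≤s z≤n)) 4^2ⁿ≤4^[4s])
  where
  open ForcingSet M S S⊆M forces
  w-balanced : Balanced (proj₁ (balanced n (ℕₚ.>⇒≢ 2≤n)))
  w-balanced = proj₂ (balanced n (ℕₚ.>⇒≢ 2≤n))
  4^2ⁿ≤4^[4s] : 4 ^ (2 ^ n) ≤ 4 ^ (4 ℕ.* length S)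
  4^2ⁿ≤4^[4s] = subst (4 ^ (2 ^ n) ≤_) (ℕₚ.^-*-assoc 4 4 (length S))
    (injective⇒^≤ Vertex↔Fin 𝔽₄↔Fin4 (Vec↔Fin^ 4 𝔽₄↔Fin4) (observe w-balanced) (observe-injective w-balanced))
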